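{- Let $p\geq3$ be a prime and let $i,m$ be integers with $1\leq i\leq p-1$ and $1\leq m\leq p$. Then $p$ divides $\left\{{i+p\atop m}\right\}_{\leq p-1}$.
   Context: For integers $n\geq k\geq0$ and $r\geq1$, $\left\{{n\atop k}\right\}_{\leq r}$ denotes the $r$-restricted Stirling number of the second kind: the number of partitions of an $n$-element set into $k$ nonempty blocks each of size at most $r$; equivalently $\frac{1}{k!}\left(\sum_{m=1}^r\frac{t^m}{m!}\right)^k=\sum_{n\geq k}\left\{{n\atop k}\right\}_{\leq r}\frac{t^n}{n!}$. -}

module Defs where

open import Data.Nat using (ℕ; zero; suc; _+_; _*_; _∸_)
open import Data.Nat.Combinatorics using (_C_)

sumBelow : ℕ → (ℕ → ℕ) → ℕ
sumBelow zero    f = 0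
sumBelow (suc b) f = sumBelow b f + f b

-- r-restricted Stirling numbers of the second kind:
-- rStirling r n k = number of partitions of an n-element set into k
-- nonempty blocks each of size at most r.
-- Recurrence (by recursion on k): for k+1 blocks of an (n+1)-set, the block
-- containing the last element has j other elements (0 ≤ j ≤ r-1, j ≤ n),
-- chosen in (n C j) ways; the remaining n-j elements form k blocks.
-- Terms with j > n vanish since n C j = 0.
rStirling : ℕ → ℕ → ℕ → ℕ
rStirling r zero    zero    = 1
rStirling r (suc n) zero    = 0
rStirling r zero    (suc k) = 0
rStirling r (suc n) (suc k) = sumBelow r (λ j → (n C j) * rStirling r (n ∸ j) k)

{-# OPTIONS --safe #-}
module Submission where

-- Write S(n, k) for the number of partitions of an n-set into k blocks of size at most r < p, and
-- let n ≥ p. Distinguishing one block and splitting by its size j + 1 gives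
--   k S(n, k) = Σ_{j<r} C(n, j+1) S(n-j-1, k-1),
-- a recurrence in which no element is special. In each term either n-j-1 ≥ p, and p ∣ S(n-j-1, k-1)
-- by induction on k, or n-j-1 < p; then p ∣ C(n, j+1), since p divides n! but neither (j+1)! nor
-- (n-j-1)! (as j+1 ≤ r < p). So p ∣ k S(n, k), whence p ∣ S(n, k) for k < p. For k = p the
-- defining recurrence writes S(n+1, p) as Σ_j C(n, j) S(n-j, p-1), whose terms are handled in the
-- same way.

open import Defs
open import Data.Nat using (ℕ; zero; suc; _+_; _*_; _∸_; _≤_; _<_; _!; _≤?_; s≤s; NonZero)
open import Data.Nat.Properties
open import Data.Nat.Divisibility
open import Data.Nat.Primality using (Prime; euclidsLemma; ¬prime[0]; ¬prime[1]; prime⇒nonZero)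
open import Data.Nat.Combinatorics using (_C_; k![n∸k]!∣n!; nCk+nC[k+1]≡[n+1]C[k+1])
open import Data.Nat.Combinatorics.Specification using (nCk≡n!/k![n-k]!; k>n⇒nCk≡0)
open import Data.Nat.DivMod using (_/_; m/n*n≡m)
open import Algebra.Properties.CommutativeSemigroup +-commutativeSemigroup
  using () renaming (interchange to +-interchange)
open import Algebra.Properties.CommutativeSemigroup *-commutativeSemigroup
  using () renaming (x∙yz≈y∙xz to x*[y*z]≡y*[x*z])
open import Data.Sum using (inj₁; inj₂)
open import Relation.Nullary using (yes; no; contradiction)
open import Relation.Binary.PropositionalEquality
open ≡-Reasoning

sumBelow-cong : ∀ b {f g : ℕ → ℕ} → (∀ j → f j ≡ g j) → sumBelow b f ≡ sumBelow b g
sumBelow-cong zero    f≗g = refl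
sumBelow-cong (suc b) f≗g = cong₂ _+_ (sumBelow-cong b f≗g) (f≗g b)

sumBelow-≡0 : ∀ b {f : ℕ → ℕ} → (∀ j → f j ≡ 0) → sumBelow b f ≡ 0
sumBelow-≡0 zero    f≗0 = refl
sumBelow-≡0 (suc b) f≗0 = cong₂ _+_ (sumBelow-≡0 b f≗0) (f≗0 b)

sumBelow-+ : ∀ b (f g : ℕ → ℕ) → sumBelow b (λ j → f j + g j) ≡ sumBelow b f + sumBelow b g
sumBelow-+ zero    f g = refl
sumBelow-+ (suc b) f g = begin
  sumBelow b (λ j → f j + g j) + (f b + g b)  ≡⟨ cong (_+ (f b + g b)) (sumBelow-+ b f g) ⟩
  (sumBelow b f + sumBelow b g) + (f b + g b) ≡⟨ +-interchange (sumBelow b f) (sumBelow b g) (f b) (g b) ⟩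
  (sumBelow b f + f b) + (sumBelow b g + g b) ∎

*-distribˡ-sumBelow : ∀ b c (f : ℕ → ℕ) → c * sumBelow b f ≡ sumBelow b (λ j → c * f j)
*-distribˡ-sumBelow zero    c f = *-zeroʳ c
*-distribˡ-sumBelow (suc b) c f = begin
  c * (sumBelow b f + f b)         ≡⟨ *-distribˡ-+ c (sumBelow b f) (f b) ⟩
  c * sumBelow b f + c * f b       ≡⟨ cong (_+ c * f b) (*-distribˡ-sumBelow b c f) ⟩
  sumBelow (suc b) (λ j → c * f j) ∎

sumBelow-comm : ∀ b c (f : ℕ → ℕ → ℕ) →
  sumBelow b (λ j → sumBelow c (f j)) ≡ sumBelow c (λ l → sumBelow b (λ j → f j l))
sumBelow-comm zero    c f = sym (sumBelow-≡0 c (λ _ → refl))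
sumBelow-comm (suc b) c f = begin
  sumBelow b (λ j → sumBelow c (f j)) + sumBelow c (f b)
    ≡⟨ cong (_+ sumBelow c (f b)) (sumBelow-comm b c f) ⟩
  sumBelow c (λ l → sumBelow b (λ j → f j l)) + sumBelow c (f b)
    ≡⟨ sumBelow-+ c (λ l → sumBelow b (λ j → f j l)) (f b) ⟨
  sumBelow c (λ l → sumBelow (suc b) (λ j → f j l)) ∎

∣-sumBelow : ∀ {d} b (f : ℕ → ℕ) → (∀ j → j < b → d ∣ f j) → d ∣ sumBelow b f
∣-sumBelow zero    f d∣f = _ ∣0
∣-sumBelow (suc b) f d∣f =
  ∣m∣n⇒∣m+n (∣-sumBelow b f (λ j j<b → d∣f j (m<n⇒m<1+n j<b))) (d∣f b ≤-refl)

∸-comm : ∀ m n o → m ∸ n ∸ o ≡ m ∸ o ∸ n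
∸-comm m n o = begin
  m ∸ n ∸ o   ≡⟨ ∸-+-assoc m n o ⟩
  m ∸ (n + o) ≡⟨ cong (m ∸_) (+-comm n o) ⟩
  m ∸ (o + n) ≡⟨ ∸-+-assoc m o n ⟨
  m ∸ o ∸ n   ∎

nCk*k![n∸k]!≡n! : ∀ {n k} → k ≤ n → (n C k) * (k ! * (n ∸ k) !) ≡ n !
nCk*k![n∸k]!≡n! {n} {k} k≤n = begin
  (n C k) * (k ! * (n ∸ k) !)            ≡⟨ cong (_* (k ! * (n ∸ k) !)) (nCk≡n!/k![n-k]! k≤n) ⟩
  n ! / (k ! * (n ∸ k) !) * (k ! * (n ∸ k) !) ≡⟨ m/n*n≡m (k![n∸k]!∣n! k≤n) ⟩
  n !                                    ∎
  where instance
  k![n∸k]!≢0 : NonZero (k ! * (n ∸ k) !)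
  k![n∸k]!≢0 = k !* (n ∸ k) !≢0

nCa*[n∸a]Cb*a!*b!*[n∸a∸b]!≡n! : ∀ {n} a b → a + b ≤ n →
  (n C a) * ((n ∸ a) C b) * (a ! * (b ! * (n ∸ a ∸ b) !)) ≡ n !
nCa*[n∸a]Cb*a!*b!*[n∸a∸b]!≡n! {n} a b a+b≤n = begin
  (n C a) * ((n ∸ a) C b) * (a ! * (b ! * (n ∸ a ∸ b) !))
    ≡⟨ *-assoc (n C a) _ _ ⟩
  (n C a) * (((n ∸ a) C b) * (a ! * (b ! * (n ∸ a ∸ b) !)))
    ≡⟨ cong ((n C a) *_) (x*[y*z]≡y*[x*z] ((n ∸ a) C b) (a !) _) ⟩
  (n C a) * (a ! * (((n ∸ a) C b) * (b ! * (n ∸ a ∸ b) !)))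
    ≡⟨ cong (λ x → (n C a) * (a ! * x)) (nCk*k![n∸k]!≡n! b≤n∸a) ⟩
  (n C a) * (a ! * (n ∸ a) !)
    ≡⟨ nCk*k![n∸k]!≡n! (m+n≤o⇒m≤o a a+b≤n) ⟩
  n ! ∎
  where
  b≤n∸a : b ≤ n ∸ a
  b≤n∸a = m+n≤o⇒m≤o∸n b (subst (_≤ n) (+-comm a b) a+b≤n)

nCa*[n∸a]Cb≡0 : ∀ {n} a b → n < a + b → (n C a) * ((n ∸ a) C b) ≡ 0
nCa*[n∸a]Cb≡0 {n} a b n<a+b with a ≤? n
... | no  a≰n = cong (_* ((n ∸ a) C b)) (k>n⇒nCk≡0 (≰⇒> a≰n))
... | yes a≤n = trans (cong ((n C a) *_) (k>n⇒nCk≡0 n∸a<b)) (*-zeroʳ (n C a))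
  where
  n∸a<b : n ∸ a < b
  n∸a<b = subst (n ∸ a <_) (m+n∸m≡n a b) (∸-monoˡ-< n<a+b a≤n)

nCa*[n∸a]Cb≡nCb*[n∸b]Ca : ∀ n a b → (n C a) * ((n ∸ a) C b) ≡ (n C b) * ((n ∸ b) C a)
nCa*[n∸a]Cb≡nCb*[n∸b]Ca n a b with a + b ≤? n
... | no a+b≰n = trans (nCa*[n∸a]Cb≡0 a b (≰⇒> a+b≰n))
                       (sym (nCa*[n∸a]Cb≡0 b a (subst (n <_) (+-comm a b) (≰⇒> a+b≰n))))
... | yes a+b≤n = *-cancelʳ-≡ _ _ (a ! * (b ! * (n ∸ a ∸ b) !)) (begin
  (n C a) * ((n ∸ a) C b) * (a ! * (b ! * (n ∸ a ∸ b) !))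
    ≡⟨ nCa*[n∸a]Cb*a!*b!*[n∸a∸b]!≡n! a b a+b≤n ⟩
  n !
    ≡⟨ nCa*[n∸a]Cb*a!*b!*[n∸a∸b]!≡n! b a (subst (_≤ n) (+-comm a b) a+b≤n) ⟨
  (n C b) * ((n ∸ b) C a) * (b ! * (a ! * (n ∸ b ∸ a) !))
    ≡⟨ cong ((n C b) * ((n ∸ b) C a) *_) (x*[y*z]≡y*[x*z] (b !) (a !) _) ⟩
  (n C b) * ((n ∸ b) C a) * (a ! * (b ! * (n ∸ b ∸ a) !))
    ≡⟨ cong (λ m → (n C b) * ((n ∸ b) C a) * (a ! * (b ! * m !))) (∸-comm n b a) ⟩
  (n C b) * ((n ∸ b) C a) * (a ! * (b ! * (n ∸ a ∸ b) !)) ∎)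
  where instance
  a!*b!*[n∸a∸b]!≢0 : NonZero (a ! * (b ! * (n ∸ a ∸ b) !))
  a!*b!*[n∸a∸b]!≢0 = m*n≢0 (a !) _ {{a !≢0}} {{m*n≢0 (b !) _ {{b !≢0}} {{(n ∸ a ∸ b) !≢0}}}}

m≤n⇒m∣n! : ∀ {m n} → .{{NonZero m}} → m ≤ n → m ∣ n !
m≤n⇒m∣n! {suc m} m≤n = ∣-trans (m∣m*n (m !)) (m≤n⇒m!∣n! m≤n)

p∤m! : ∀ {p m} → Prime p → m < p → p ∤ m !
p∤m! {m = zero}  p-prime _   p∣1 = ¬prime[1] (subst Prime (∣1⇒≡1 p∣1) p-prime)
p∤m! {m = suc m} p-prime m<p p∣m! with euclidsLemma (suc m) (m !) p-prime p∣m!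
... | inj₁ p∣1+m = >⇒∤ m<p p∣1+m
... | inj₂ p∣m!  = p∤m! p-prime (<-trans (n<1+n m) m<p) p∣m!

p∣nCk : ∀ {p n k} → Prime p → p ≤ n → k < p → n ∸ k < p → p ∣ n C k
p∣nCk {p} {n} {k} p-prime p≤n k<p n∸k<p
  with euclidsLemma (n C k) (k ! * (n ∸ k) !) p-prime p∣nCk*k![n∸k]!
  where
  p∣nCk*k![n∸k]! : p ∣ (n C k) * (k ! * (n ∸ k) !)
  p∣nCk*k![n∸k]! = subst (p ∣_) (sym (nCk*k![n∸k]!≡n! (≤-trans (<⇒≤ k<p) p≤n)))
                         (m≤n⇒m∣n! {{prime⇒nonZero p-prime}} p≤n)
... | inj₁ p∣nCk = p∣nCk
... | inj₂ p∣k![n∸k]! with euclidsLemma (k !) ((n ∸ k) !) p-prime p∣k![n∸k]!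
...   | inj₁ p∣k!     = contradiction p∣k! (p∤m! p-prime k<p)
...   | inj₂ p∣[n∸k]! = contradiction p∣[n∸k]! (p∤m! p-prime n∸k<p)

nC[1+j]*f[n∸j]≡nC[1+j]*f[1+[n∸[1+j]]] : ∀ n j (f : ℕ → ℕ) →
  (n C suc j) * f (n ∸ j) ≡ (n C suc j) * f (suc (n ∸ suc j))
nC[1+j]*f[n∸j]≡nC[1+j]*f[1+[n∸[1+j]]] n j f with suc j ≤? n
... | yes j<n = cong (λ m → (n C suc j) * f m) (+-∸-assoc 1 j<n)
... | no  j≮n = trans (cong (_* f (n ∸ j)) nC[1+j]≡0)
                      (sym (cong (_* f (suc (n ∸ suc j))) nC[1+j]≡0))
  where
  nC[1+j]≡0 : n C suc j ≡ 0
  nC[1+j]≡0 = k>n⇒nCk≡0 (≰⇒> j≮n)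

-- Both sides count partitions into k + 1 blocks, one of which is distinguished and has j + 1
-- elements; in the second identity the distinguished block avoids the last element.
mutual
  rStirling-distinguishedBlock : ∀ r n k →
    sumBelow r (λ j → (n C suc j) * rStirling r (n ∸ suc j) k) ≡ suc k * rStirling r n (suc k)
  rStirling-distinguishedBlock r zero    k =
    trans (sumBelow-≡0 r (λ _ → refl)) (sym (*-zeroʳ (suc k)))
  rStirling-distinguishedBlock r (suc n) k = begin
    sumBelow r (λ j → (suc n C suc j) * S (n ∸ j) k)
      ≡⟨ sumBelow-cong r (λ j → cong (_* S (n ∸ j) k) (nCk+nC[k+1]≡[n+1]C[k+1] n j)) ⟨
    sumBelow r (λ j → ((n C j) + (n C suc j)) * S (n ∸ j) k)
      ≡⟨ sumBelow-cong r (λ j → *-distribʳ-+ (S (n ∸ j) k) (n C j) (n C suc j)) ⟩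
    sumBelow r (λ j → (n C j) * S (n ∸ j) k + (n C suc j) * S (n ∸ j) k)
      ≡⟨ sumBelow-+ r _ _ ⟩
    S (suc n) (suc k) + sumBelow r (λ j → (n C suc j) * S (n ∸ j) k)
      ≡⟨ cong (S (suc n) (suc k) +_) (rStirling-distinguishedBlockWithoutLast r n k) ⟩
    suc k * S (suc n) (suc k) ∎
    where
      S : ℕ → ℕ → ℕ
      S = rStirling r

  rStirling-distinguishedBlockWithoutLast : ∀ r n k →
    sumBelow r (λ j → (n C suc j) * rStirling r (n ∸ j) k) ≡ k * rStirling r (suc n) (suc k)
  rStirling-distinguishedBlockWithoutLast r n zero = sumBelow-≡0 r λ j → begin
    (n C suc j) * rStirling r (n ∸ j) 0
      ≡⟨ nC[1+j]*f[n∸j]≡nC[1+j]*f[1+[n∸[1+j]]] n j (λ m → rStirling r m 0) ⟩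
    (n C suc j) * 0
      ≡⟨ *-zeroʳ (n C suc j) ⟩
    0 ∎
  rStirling-distinguishedBlockWithoutLast r n (suc k) = begin
    sumBelow r (λ j → (n C suc j) * S (n ∸ j) (suc k))
      ≡⟨ sumBelow-cong r (λ j → nC[1+j]*f[n∸j]≡nC[1+j]*f[1+[n∸[1+j]]] n j (λ m → S m (suc k))) ⟩
    sumBelow r (λ j → (n C suc j) * sumBelow r (λ l → ((n ∸ suc j) C l) * S (n ∸ suc j ∸ l) k))
      ≡⟨ sumBelow-cong r (λ j → *-distribˡ-sumBelow r (n C suc j) _) ⟩
    sumBelow r (λ j → sumBelow r (λ l → (n C suc j) * (((n ∸ suc j) C l) * S (n ∸ suc j ∸ l) k)))
      ≡⟨ sumBelow-comm r r _ ⟩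
    sumBelow r (λ l → sumBelow r (λ j → (n C suc j) * (((n ∸ suc j) C l) * S (n ∸ suc j ∸ l) k)))
      ≡⟨ sumBelow-cong r (λ l → sumBelow-cong r (λ j → choose-in-either-order (suc j) l)) ⟩
    sumBelow r (λ l → sumBelow r (λ j → (n C l) * (((n ∸ l) C suc j) * S (n ∸ l ∸ suc j) k)))
      ≡⟨ sumBelow-cong r (λ l → *-distribˡ-sumBelow r (n C l) _) ⟨
    sumBelow r (λ l → (n C l) * sumBelow r (λ j → ((n ∸ l) C suc j) * S (n ∸ l ∸ suc j) k))
      ≡⟨ sumBelow-cong r (λ l → cong ((n C l) *_) (rStirling-distinguishedBlock r (n ∸ l) k)) ⟩
    sumBelow r (λ l → (n C l) * (suc k * S (n ∸ l) (suc k)))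
      ≡⟨ sumBelow-cong r (λ l → x*[y*z]≡y*[x*z] (n C l) (suc k) _) ⟩
    sumBelow r (λ l → suc k * ((n C l) * S (n ∸ l) (suc k)))
      ≡⟨ *-distribˡ-sumBelow r (suc k) _ ⟨
    suc k * S (suc n) (suc (suc k)) ∎
    where
      S : ℕ → ℕ → ℕ
      S = rStirling r
      choose-in-either-order : ∀ a b →
        (n C a) * (((n ∸ a) C b) * S (n ∸ a ∸ b) k) ≡ (n C b) * (((n ∸ b) C a) * S (n ∸ b ∸ a) k)
      choose-in-either-order a b = begin
        (n C a) * (((n ∸ a) C b) * S (n ∸ a ∸ b) k) ≡⟨ *-assoc (n C a) _ _ ⟨
        (n C a) * ((n ∸ a) C b) * S (n ∸ a ∸ b) k   ≡⟨ cong₂ _*_ (nCa*[n∸a]Cb≡nCb*[n∸b]Ca n a b)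
                                                                 (cong (λ m → S m k) (∸-comm n a b)) ⟩
        (n C b) * ((n ∸ b) C a) * S (n ∸ b ∸ a) k   ≡⟨ *-assoc (n C b) _ _ ⟩
        (n C b) * (((n ∸ b) C a) * S (n ∸ b ∸ a) k) ∎

p∣nCj*f[n∸j] : ∀ {p n j} {f : ℕ → ℕ} → Prime p → (∀ {m} → p ≤ m → p ∣ f m) →
  p ≤ n → j < p → p ∣ (n C j) * f (n ∸ j)
p∣nCj*f[n∸j] {p} {n} {j} p-prime p∣f p≤n j<p with p ≤? n ∸ j
... | yes p≤n∸j = ∣n⇒∣m*n (n C j) (p∣f p≤n∸j)
... | no  p≰n∸j = ∣m⇒∣m*n _ (p∣nCk p-prime p≤n j<p (≰⇒> p≰n∸j))

p∣rStirling : ∀ {p r n k} → Prime p → r < p → k < p → p ≤ n → p ∣ rStirling r n k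
p∣rStirling {n = zero}         p-prime _ _ p≤0 =
  contradiction (subst Prime (n≤0⇒n≡0 p≤0) p-prime) ¬prime[0]
p∣rStirling {n = suc n} {zero} _       _ _ _   = _ ∣0
p∣rStirling {p} {r} {n} {suc k} p-prime r<p k<p p≤n
  with euclidsLemma (suc k) (rStirling r n (suc k)) p-prime p∣[1+k]*S[n,1+k]
  where
  p∣[1+k]*S[n,1+k] : p ∣ suc k * rStirling r n (suc k)
  p∣[1+k]*S[n,1+k] = subst (p ∣_) (rStirling-distinguishedBlock r n k) (∣-sumBelow r _ λ j j<r →
    p∣nCj*f[n∸j] p-prime (p∣rStirling p-prime r<p (<-trans (n<1+n k) k<p)) p≤n
                 (≤-trans (s≤s j<r) r<p))
... | inj₁ p∣1+k      = contradiction p∣1+k (>⇒∤ k<p)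
... | inj₂ p∣S[n,1+k] = p∣S[n,1+k]

p∣rStirling[1+n,p] : ∀ {q r n} → Prime (suc q) → r ≤ q → suc q ≤ n →
  suc q ∣ rStirling r (suc n) (suc q)
p∣rStirling[1+n,p] {r = r} p-prime r≤q p≤n = ∣-sumBelow r _ λ j j<r →
  p∣nCj*f[n∸j] p-prime (p∣rStirling p-prime (s≤s r≤q) ≤-refl) p≤n (m<n⇒m<1+n (≤-trans j<r r≤q))

lemma2p2 : (p i m : ℕ) → Prime p → 3 ≤ p → 1 ≤ i → i ≤ p ∸ 1 → 1 ≤ m → m ≤ p →
    p ∣ rStirling (p ∸ 1) (i + p) m
lemma2p2 (suc q) (suc a) m p-prime _ _ _ _ m≤p with m≤n⇒m<n∨m≡n m≤p
... | inj₁ m<p  = p∣rStirling p-prime ≤-refl m<p (m≤n+m (suc q) (suc a))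
... | inj₂ refl = p∣rStirling[1+n,p] p-prime ≤-refl (m≤n+m (suc q) a)
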